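{- Let $F(X,Y)$ be a propositional CNF formula and consider $\exists X[F]$. Let $C$ be a clause of $F$ that is blocked in $F$ at a variable $w\in X$ with respect to $Y$. Then $F\setminus\{C\}$ es-implies $C$ with respect to $Y$, i.e. $\exists X[F]\equiv\exists X[F\setminus\{C\}]$.
   Context: A CNF formula is viewed as a set of clauses. For an assignment $q$ to some variables, $C_q\equiv 1$ if $q$ satisfies clause $C$, otherwise $C_q$ is $C$ with all literals falsified by $q$ removed; $H_q$ is obtained from $H$ by removing clauses satisfied by $q$ and replacing every other clause $C$ by $C_q$. Formulas possibly with existential quantifiers $G,H$ are equivalent ($G\equiv H$) if $G_q=H_q$ for every full assignment $q$ to their free variables. Two clauses are resolvable on $w$ if they contain opposite literals of exactly one variable, namely $w$ (clauses with opposite literals of more than one variable are considered unresolvable). Given formulas $F(X,Y),G(X,Y)$, $F$ es-implies $G$ with respect to $Y$ if $\exists X[F\wedge G]\equiv\exists X[F]$, i.e. for every full assignment $y$ to $Y$, $(F\wedge G)_y$ and $F_y$ are equisatisfiable. Blocked clause: given $\exists X[F(X,Y)]$ and a clause $C\in F$, let $G$ be the set of clauses of $F$ resolvable with $C$ on a variable $w\in X$, and let $w=b$ ($b\in\{0,1\}$) satisfy $C$. Then $C$ is blocked in $F$ at $w$ with respect to $Y$ if $(F\setminus G)_{w=b}$ es-implies $G_{w=b}$ with respect to $Y$. -}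

module Defs where

open import Data.Nat using (ℕ; _≡ᵇ_)
open import Data.Bool using (Bool; true; false; not; _∧_; _∨_; if_then_else_; T)
open import Data.Maybe using (Maybe; just; nothing)
open import Data.Product using (_×_; _,_; proj₁; proj₂; Σ; ∃)
open import Data.List using (List; []; _∷_; _++_; map; filterᵇ)
open import Data.Bool.ListAction using (any; all)
open import Data.List.Relation.Unary.All using (All)
open import Data.List.Relation.Unary.Any using (Any)
open import Data.List.Membership.Propositional using (_∈_)
open import Relation.Binary.PropositionalEquality using (_≡_)
open import Function.Bundles using (_⇔_)

-- Variables are natural numbers.  A literal is a pair (v , p):
-- p = true means the positive literal v, p = false the negative literal ¬v.
Var : Set
Var = ℕ

Lit : Set
Lit = Var × Bool

var : Lit → Var
var = proj₁

pol : Lit → Bool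
pol = proj₂

_==B_ : Bool → Bool → Bool
true  ==B b = b
false ==B b = not b

Clause : Set
Clause = List Lit

CNF : Set
CNF = List Clause

litEq : Lit → Lit → Bool
litEq (v , p) (u , q) = (v ≡ᵇ u) ∧ (p ==B q)

clauseEq : Clause → Clause → Bool
clauseEq []       []       = true
clauseEq (l ∷ ls) (k ∷ ks) = litEq l k ∧ clauseEq ls ks
clauseEq _        _        = false

-- Partial assignments: nothing = unassigned.
PAssign : Set
PAssign = Var → Maybe Bool

litVal : PAssign → Lit → Maybe Bool
litVal q (v , p) with q v
... | nothing = nothing
... | just b  = just (b ==B p)

litSatᵇ : PAssign → Lit → Bool
litSatᵇ q l with litVal q l
... | just true = true
... | _         = false

litFalsifiedᵇ : PAssign → Lit → Bool
litFalsifiedᵇ q l with litVal q l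
... | just false = true
... | _          = false

clauseSatᵇ : PAssign → Clause → Bool
clauseSatᵇ q C = any (litSatᵇ q) C

restrictClause : PAssign → Clause → Clause
restrictClause q C = filterᵇ (λ l → not (litFalsifiedᵇ q l)) C

restrict : PAssign → CNF → CNF
restrict q H = map (restrictClause q) (filterᵇ (λ C → not (clauseSatᵇ q C)) H)

Assign : Set
Assign = Var → Bool

evalLit : Assign → Lit → Bool
evalLit a (v , p) = a v ==B p

Satisfies : Assign → CNF → Set
Satisfies a H = All (λ C → Any (λ l → evalLit a l ≡ true) C) H

Satisfiable : CNF → Set
Satisfiable H = ∃ λ (a : Assign) → Satisfies a H

Equisat : CNF → CNF → Set
Equisat G H = Satisfiable G ⇔ Satisfiable H

-- The partition of variables into X and Y is given by isX : Var → Bool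
-- (isX v = true means v ∈ X, otherwise v ∈ Y).
assignY : (Var → Bool) → (Var → Bool) → PAssign
assignY isX y v = if isX v then nothing else just (y v)

assign1 : Var → Bool → PAssign
assign1 w b v = if v ≡ᵇ w then just b else nothing

EsImplies : (Var → Bool) → CNF → CNF → Set
EsImplies isX F G = (y : Var → Bool) → Equisat (restrict (assignY isX y) (F ++ G)) (restrict (assignY isX y) F)

-- ∃X[G] ≡ ∃X[H]: for every full assignment y to the free variables Y,
-- G_y and H_y are equisatisfiable (truth values of ∃X[G]_y, ∃X[H]_y agree).
ExEquiv : (Var → Bool) → CNF → CNF → Set
ExEquiv isX G H = (y : Var → Bool) → Equisat (restrict (assignY isX y) G) (restrict (assignY isX y) H)

clashᵇ : Clause → Clause → Var → Bool
clashᵇ C D v = any (λ l → (var l ≡ᵇ v) ∧ any (λ k → (var k ≡ᵇ v) ∧ not (pol k ==B pol l)) D) C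

resolvableOnᵇ : Clause → Clause → Var → Bool
resolvableOnᵇ C D w = clashᵇ C D w ∧ all (λ l → not (clashᵇ C D (var l)) ∨ (var l ≡ᵇ w)) C

resolvents : CNF → Clause → Var → CNF
resolvents F C w = filterᵇ (λ D → resolvableOnᵇ C D w) F

nonResolvents : CNF → Clause → Var → CNF
nonResolvents F C w = filterᵇ (λ D → not (resolvableOnᵇ C D w)) F

removeClause : CNF → Clause → CNF
removeClause F C = filterᵇ (λ D → not (clauseEq D C)) F

Blocked : (Var → Bool) → CNF → Clause → Var → Set
Blocked isX F C w =
  Σ Bool λ b → ((w , b) ∈ C) ×
    EsImplies isX (restrict (assign1 w b) (nonResolvents F C w))
                  (restrict (assign1 w b) (resolvents F C w))

{-# OPTIONS --safe #-}
module Submission where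

-- Let y extend to a model c of F ∖ {C}; we must make C true as well.  If c
-- falsifies C, set w := b.  A clause D not resolvable with C on w stays true:
-- if D relied on the literal of w opposite to (w , b), then D clashes with C
-- on w and hence, not being resolvable, on some other variable u; as c
-- falsifies C, c satisfies the literal of D on u, which the flip leaves alone.
-- So y extends to a model of (F ∖ G)_{w=b}; by blocking, y then extends to a
-- model of (F ∖ G)_{w=b} ∧ G_{w=b}, which together with w := b satisfies F.

open import Defs
open import Data.Bool using (Bool; true; false; not; _∨_; T; T?; _≟_)
open import Data.Bool.Properties using (T-≡; T-not-≡; T-∧; ¬-not; not-involutive)
open import Data.Empty using (⊥-elim)
open import Data.Maybe using (just; nothing; fromMaybe)
open import Data.Nat using (_≡ᵇ_)
import Data.Nat.Properties as ℕ
open import Data.Product using (∃; ∃₂; _×_; _,_; proj₂)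
import Data.Product as Product
open import Data.Sum using (_⊎_; inj₁; inj₂; [_,_])
open import Data.List using ([]; _∷_; _++_; map; filter; filterᵇ)
open import Data.List.Properties using (map-++; filter-++)
open import Data.List.Relation.Unary.All as All using (All; []; _∷_)
open import Data.List.Relation.Unary.All.Properties
  using (++⁺; ++⁻ˡ; ++⁻ʳ; map⁺; filter⁺; all⁻; ¬All⇒Any¬)
open import Data.List.Relation.Unary.Any as Any using (Any; any?)
open import Data.List.Relation.Unary.Any.Properties using (any⁺; any⁻)
open import Data.List.Membership.Propositional using (_∈_; find; lose)
open import Data.List.Membership.Propositional.Properties
  using (∈-filter⁺; ∈-filter⁻; ∈-map⁺)
open import Function using (_∘_)
open import Function.Bundles using (_⇔_; mk⇔; Equivalence)
import Function.Properties.Equivalence as ⇔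
open import Relation.Binary.PropositionalEquality
  using (_≡_; _≢_; refl; sym; trans; cong; cong₂; subst)
open import Relation.Nullary using (¬_; yes; no; contradiction)

open Equivalence using (to; from)

==B⇔≡ : ∀ {x y} → T (x ==B y) ⇔ x ≡ y
==B⇔≡ {true}  {true}  = mk⇔ (λ _ → refl) _
==B⇔≡ {true}  {false} = mk⇔ (λ ()) (λ ())
==B⇔≡ {false} {true}  = mk⇔ (λ ()) (λ ())
==B⇔≡ {false} {false} = mk⇔ (λ _ → refl) _

not-==B⇔≢ : ∀ {x y} → T (not (x ==B y)) ⇔ x ≢ y
not-==B⇔≢ {true}  {true}  = mk⇔ (λ ()) (λ x≢x → x≢x refl)
not-==B⇔≢ {true}  {false} = mk⇔ (λ _ ()) _
not-==B⇔≢ {false} {true}  = mk⇔ (λ _ ()) _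
not-==B⇔≢ {false} {false} = mk⇔ (λ ()) (λ x≢x → x≢x refl)

T-not⇒¬T : ∀ {x} → T (not x) → ¬ T x
T-not⇒¬T {false} _ ()

¬T-not-∨ : ∀ x {y} → ¬ T (not x ∨ y) → T x × ¬ T y
¬T-not-∨ true  {y} ¬t = _ , ¬t
¬T-not-∨ false     ¬t = ⊥-elim (¬t _)

≢-same-≡ : ∀ {x y z : Bool} → x ≢ z → y ≢ z → x ≡ y
≢-same-≡ x≢z y≢z = trans (¬-not x≢z) (sym (¬-not y≢z))

evalLit≡true⇔ : ∀ c {v p} → evalLit c (v , p) ≡ true ⇔ c v ≡ p
evalLit≡true⇔ c = ⇔.trans (⇔.sym T-≡) ==B⇔≡

∈-filterᵇ⊎ : ∀ {A : Set} (p : A → Bool) {x xs} →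
             x ∈ xs → x ∈ filterᵇ p xs ⊎ x ∈ filterᵇ (not ∘ p) xs
∈-filterᵇ⊎ p {x} x∈xs with p x in px
... | true  = inj₁ (∈-filter⁺ (T? ∘ p) x∈xs (from T-≡ px))
... | false = inj₂ (∈-filter⁺ (T? ∘ (not ∘ p)) x∈xs (from T-not-≡ px))

All-filterᵇ⁻ : ∀ {A : Set} {P : A → Set} (p : A → Bool) {xs} →
               All P (filterᵇ p xs) → All P (filterᵇ (not ∘ p) xs) → All P xs
All-filterᵇ⁻ p Pxs⁺ Pxs⁻ =
  All.tabulate λ x∈xs → [ All.lookup Pxs⁺ , All.lookup Pxs⁻ ] (∈-filterᵇ⊎ p x∈xs)

SatisfiesClause : Assign → Clause → Set
SatisfiesClause c D = Any (λ l → evalLit c l ≡ true) D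

litEq-sound : ∀ l k → T (litEq l k) → l ≡ k
litEq-sound (v , p) (u , q) t with to T-∧ t
... | v≡u , p≡q = cong₂ _,_ (ℕ.≡ᵇ⇒≡ v u v≡u) (to ==B⇔≡ p≡q)

clauseEq-sound : ∀ D C → T (clauseEq D C) → D ≡ C
clauseEq-sound []      []      _ = refl
clauseEq-sound (l ∷ D) (k ∷ C) t with to T-∧ t
... | l≡k , D≡C = cong₂ _∷_ (litEq-sound l k l≡k) (clauseEq-sound D C D≡C)

∈-removeClause⊎ : ∀ {F C D} → D ∈ F → D ≡ C ⊎ D ∈ removeClause F C
∈-removeClause⊎ {F} {C} {D} D∈F with ∈-filterᵇ⊎ (λ D → clauseEq D C) D∈F
... | inj₁ D∈C = inj₁ (clauseEq-sound D C (proj₂ (∈-filter⁻ (T? ∘ λ D → clauseEq D C) {xs = F} D∈C)))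
... | inj₂ D∈F∖C = inj₂ D∈F∖C

satisfies-removeClause : ∀ {c F} C → Satisfies c F → Satisfies c (removeClause F C)
satisfies-removeClause C = filter⁺ (T? ∘ λ D → not (clauseEq D C))

satisfies-restoreClause : ∀ {c} F C → Satisfies c (removeClause F C) → SatisfiesClause c C → Satisfies c F
satisfies-restoreClause F C sat-F∖C sat-C =
  All.tabulate λ D∈F → [ (λ { refl → sat-C }) , All.lookup sat-F∖C ] (∈-removeClause⊎ D∈F)

satisfies-removeClause-++ : ∀ {F C} → C ∈ F → ∀ c →
  Satisfies c (removeClause F C ++ C ∷ []) ⇔ Satisfies c F
satisfies-removeClause-++ {F} {C} C∈F c = mk⇔
  (λ sat → satisfies-restoreClause {c} F C (++⁻ˡ (removeClause F C) sat)
                                            (All.head (++⁻ʳ (removeClause F C) sat)))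
  (λ sat → ++⁺ (satisfies-removeClause {c} C sat) (All.lookup sat C∈F ∷ []))

Extends : Assign → PAssign → Set
Extends c q = ∀ v b → q v ≡ just b → c v ≡ b

override : PAssign → Assign → Assign
override q a v = fromMaybe (a v) (q v)

override-extends : ∀ q a → Extends (override q a) q
override-extends q a v b qv rewrite qv = refl

override-undefined : ∀ {q a v} → q v ≡ nothing → override q a v ≡ a v
override-undefined qv rewrite qv = refl

Disjoint : PAssign → PAssign → Set
Disjoint p q = ∀ v → p v ≡ nothing ⊎ q v ≡ nothing

override-extends-disjoint : ∀ {p q c} → Disjoint p q → Extends c p → Extends (override q c) p
override-extends-disjoint {p} {q} {c} disj c⊒p v b pv with disj v
... | inj₁ pv≡nothing = contradiction (trans (sym pv) pv≡nothing) λ ()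
... | inj₂ qv≡nothing = trans (override-undefined {q} {c} qv≡nothing) (c⊒p v b pv)

litVal-extends : ∀ {q c} → Extends c q → ∀ l →
  litVal q l ≡ nothing ⊎ litVal q l ≡ just (evalLit c l)
litVal-extends {q} c⊒q (v , p) with q v in qv
... | nothing = inj₁ refl
... | just x rewrite c⊒q v x qv = inj₂ refl

litSatᵇ-just : ∀ {q l x} → litVal q l ≡ just x → litSatᵇ q l ≡ x
litSatᵇ-just {q} {l} eq with litVal q l
litSatᵇ-just refl | just true  = refl
litSatᵇ-just refl | just false = refl

litSatᵇ-nothing : ∀ {q l} → litVal q l ≡ nothing → litSatᵇ q l ≡ false
litSatᵇ-nothing {q} {l} eq with litVal q l
litSatᵇ-nothing refl | nothing = refl

litFalsifiedᵇ-just : ∀ {q l x} → litVal q l ≡ just x → litFalsifiedᵇ q l ≡ not x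
litFalsifiedᵇ-just {q} {l} eq with litVal q l
litFalsifiedᵇ-just refl | just true  = refl
litFalsifiedᵇ-just refl | just false = refl

litFalsifiedᵇ-nothing : ∀ {q l} → litVal q l ≡ nothing → litFalsifiedᵇ q l ≡ false
litFalsifiedᵇ-nothing {q} {l} eq with litVal q l
litFalsifiedᵇ-nothing refl | nothing = refl

satisfied-lit-survives : ∀ {q c} → Extends c q → ∀ l → evalLit c l ≡ true → litFalsifiedᵇ q l ≡ false
satisfied-lit-survives {q} {c} c⊒q l sat with litVal-extends {q} {c} c⊒q l
... | inj₁ undef = litFalsifiedᵇ-nothing {q} {l} undef
... | inj₂ val   = trans (litFalsifiedᵇ-just {q} {l} val) (cong not sat)

litSatᵇ-extends : ∀ {q c} → Extends c q → ∀ l → litSatᵇ q l ≡ true → evalLit c l ≡ true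
litSatᵇ-extends {q} {c} c⊒q l sat with litVal-extends {q} {c} c⊒q l
... | inj₁ undef = contradiction (trans (sym sat) (litSatᵇ-nothing {q} {l} undef)) λ ()
... | inj₂ val   = trans (sym (litSatᵇ-just {q} {l} val)) sat

litVal-nothing : ∀ {q} v p → litVal q (v , p) ≡ nothing → q v ≡ nothing
litVal-nothing {q} v p undef with q v
... | nothing = refl

unfalsified-lit-override : ∀ q a l → litFalsifiedᵇ q l ≡ false → evalLit a l ≡ true →
                           evalLit (override q a) l ≡ true
unfalsified-lit-override q a (v , p) unfalsified sat
  with litVal-extends {q} {override q a} (override-extends q a) (v , p)
... | inj₁ undef = trans (cong (_==B p) (override-undefined {q} {a} (litVal-nothing {q} v p undef))) sat
... | inj₂ val   = trans (sym (not-involutive _))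
                         (cong not (trans (sym (litFalsifiedᵇ-just {q} {v , p} val)) unfalsified))

satisfies-restrictClause : ∀ {q c D} → Extends c q →
                           SatisfiesClause c D → SatisfiesClause c (restrictClause q D)
satisfies-restrictClause {q} {c} c⊒q sat with find sat
... | l , l∈D , l-true =
  lose (∈-filter⁺ (T? ∘ λ l → not (litFalsifiedᵇ q l)) l∈D
          (from T-not-≡ (satisfied-lit-survives {q} {c} c⊒q l l-true)))
       l-true

satisfies-restrict : ∀ {q c} H → Extends c q → Satisfies c H → Satisfies c (restrict q H)
satisfies-restrict {q} {c} H c⊒q sat =
  map⁺ (filter⁺ (T? ∘ λ D → not (clauseSatᵇ q D))
                (All.map (satisfies-restrictClause {q} {c} c⊒q) sat))

override-satisfies-clause : ∀ q a D → SatisfiesClause a (restrictClause q D) →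
                            SatisfiesClause (override q a) D
override-satisfies-clause q a D sat with find sat
... | l , l∈D|q , l-true with ∈-filter⁻ (T? ∘ λ l → not (litFalsifiedᵇ q l)) {xs = D} l∈D|q
... | l∈D , unfalsified =
  lose l∈D (unfalsified-lit-override q a l (to T-not-≡ unfalsified) l-true)

override-satisfies : ∀ q a H → Satisfies a (restrict q H) → Satisfies (override q a) H
override-satisfies q a H sat = All.tabulate clause
  where
  clause : ∀ {D} → D ∈ H → SatisfiesClause (override q a) D
  clause {D} D∈H with clauseSatᵇ q D in satisfied
  ... | true  = Any.map (λ {l} → litSatᵇ-extends {q} {override q a} (override-extends q a) l ∘ to T-≡)
                        (any⁻ (litSatᵇ q) D (from T-≡ satisfied))
  ... | false = override-satisfies-clause q a D
                  (All.lookup sat (∈-map⁺ (restrictClause q)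
                    (∈-filter⁺ (T? ∘ λ D → not (clauseSatᵇ q D)) D∈H (from T-not-≡ satisfied))))

ModelExtending : PAssign → CNF → Set
ModelExtending q H = ∃ λ c → Extends c q × Satisfies c H

satisfiable-restrict⇔ : ∀ {q} H → Satisfiable (restrict q H) ⇔ ModelExtending q H
satisfiable-restrict⇔ {q} H = mk⇔
  (λ (a , sat) → override q a , override-extends q a , override-satisfies q a H sat)
  (λ (c , c⊒q , sat) → c , satisfies-restrict H c⊒q sat)

satisfiable-restrict-cong : ∀ {q G H} → (∀ c → Satisfies c G ⇔ Satisfies c H) →
                            Satisfiable (restrict q G) ⇔ Satisfiable (restrict q H)
satisfiable-restrict-cong {G = G} {H} G⇔H =
  ⇔.trans (satisfiable-restrict⇔ G)
          (⇔.trans (mk⇔ (λ (c , model) → c , Product.map₂ (to (G⇔H c)) model)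
                        (λ (c , model) → c , Product.map₂ (from (G⇔H c)) model))
                   (⇔.sym (satisfiable-restrict⇔ H)))

model-of-restrict : ∀ {p q} H → Disjoint p q → ModelExtending p (restrict q H) → ModelExtending p H
model-of-restrict {p} {q} H disj (c , c⊒p , sat) =
  override q c , override-extends-disjoint {p} {q} {c} disj c⊒p , override-satisfies q c H sat

restrict-++ : ∀ q G H → restrict q (G ++ H) ≡ restrict q G ++ restrict q H
restrict-++ q G H = trans (cong (map (restrictClause q)) (filter-++ unsatisfied? G H))
                          (map-++ (restrictClause q) (filter unsatisfied? G) (filter unsatisfied? H))
  where unsatisfied? = T? ∘ λ D → not (clauseSatᵇ q D)

Clash : Clause → Clause → Var → Set
Clash C D v = ∃₂ λ p q → (v , p) ∈ C × (v , q) ∈ D × q ≢ p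

≡ᵇ-refl : ∀ v → T (v ≡ᵇ v)
≡ᵇ-refl v = ℕ.≡⇒≡ᵇ v v refl

clashᵇ-complete : ∀ {C D v} → Clash C D v → T (clashᵇ C D v)
clashᵇ-complete {v = v} (p , q , vp∈C , vq∈D , q≢p) =
  any⁺ _ (lose vp∈C (from T-∧ (≡ᵇ-refl v ,
    any⁺ _ (lose vq∈D (from T-∧ (≡ᵇ-refl v , from not-==B⇔≢ q≢p))))))

clashᵇ-sound : ∀ {C D v} → T (clashᵇ C D v) → Clash C D v
clashᵇ-sound {C} {D} {v} clash with find (any⁻ _ C clash)
... | (u , p) , up∈C , t₁ with to T-∧ t₁
... | u≡v , t₂ with find (any⁻ _ D t₂)
... | (u′ , q) , u′q∈D , t₃ with to T-∧ t₃
... | u′≡v , q≢p with ℕ.≡ᵇ⇒≡ u v u≡v | ℕ.≡ᵇ⇒≡ u′ v u′≡v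
... | refl | refl = p , q , up∈C , u′q∈D , to not-==B⇔≢ q≢p

nonResolvable⇒clash-elsewhere : ∀ {C D w} → T (clashᵇ C D w) → ¬ T (resolvableOnᵇ C D w) →
                      ∃ λ u → u ≢ w × T (clashᵇ C D u)
nonResolvable⇒clash-elsewhere {C} {D} {w} clash ¬res =
  let l , _ , ¬unique = find (¬All⇒Any¬ (T? ∘ unique) C (¬res ∘ from T-∧ ∘ (clash ,_) ∘ all⁻ unique))
      clash-l , l≢w = ¬T-not-∨ (clashᵇ C D (var l)) ¬unique
  in var l , l≢w ∘ ℕ.≡⇒≡ᵇ (var l) w , clash-l
  where
  unique : Lit → Bool
  unique l = not (clashᵇ C D (var l)) ∨ (var l ≡ᵇ w)

assign1-self : ∀ w b → assign1 w b w ≡ just b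
assign1-self w b rewrite to T-≡ (≡ᵇ-refl w) = refl

assign1-≢ : ∀ {w b v} → v ≢ w → assign1 w b v ≡ nothing
assign1-≢ {w} {b} {v} v≢w with v ≡ᵇ w in v≡ᵇw
... | true  = contradiction (ℕ.≡ᵇ⇒≡ v w (from T-≡ v≡ᵇw)) v≢w
... | false = refl

assignY-assign1-disjoint : ∀ {isX w} y b → isX w ≡ true → Disjoint (assignY isX y) (assign1 w b)
assignY-assign1-disjoint {isX} {w} y b isXw v with v ℕ.≟ w
... | yes refl rewrite isXw = inj₁ refl
... | no v≢w = inj₂ (assign1-≢ v≢w)

module _ {c : Assign} {C : Clause} {w : Var} {b : Bool}
         (¬sat-C : ¬ SatisfiesClause c C) (wb∈C : (w , b) ∈ C) where

  private
    c′ : Assign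
    c′ = override (assign1 w b) c

    falsified : ∀ {v p} → (v , p) ∈ C → c v ≢ p
    falsified vp∈C cv≡p = ¬sat-C (lose vp∈C (from (evalLit≡true⇔ c) cv≡p))

    clash-satisfied : ∀ {D u} → Clash C D u → ∃ λ q → (u , q) ∈ D × c u ≡ q
    clash-satisfied (p , q , up∈C , uq∈D , q≢p) = q , uq∈D , ≢-same-≡ (falsified up∈C) q≢p

    flip-keeps : ∀ {D u q} → u ≢ w → (u , q) ∈ D → c u ≡ q → SatisfiesClause c′ D
    flip-keeps {u = u} {q} u≢w uq∈D cu≡q =
      lose uq∈D (from (evalLit≡true⇔ c′ {u} {q})
                      (trans (override-undefined {assign1 w b} {c} {u} (assign1-≢ u≢w)) cu≡q))

  flip-satisfies-clause : SatisfiesClause c′ C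
  flip-satisfies-clause =
    lose wb∈C (from (evalLit≡true⇔ c′ {w}) (override-extends (assign1 w b) c w b (assign1-self w b)))

  flip-satisfies-nonResolvent : ∀ {D} → ¬ T (resolvableOnᵇ C D w) → SatisfiesClause c D →
                                SatisfiesClause c′ D
  flip-satisfies-nonResolvent {D} ¬res sat with find sat
  ... | (v , p) , vp∈D , vp-true with v ℕ.≟ w
  ... | no v≢w = flip-keeps v≢w vp∈D (to (evalLit≡true⇔ c) vp-true)
  ... | yes refl =
    let clash-w           = clashᵇ-complete (b , p , wb∈C , vp∈D , p≢b)
        u , u≢w , clash-u = nonResolvable⇒clash-elsewhere {C} {D} clash-w ¬res
        q , uq∈D , cu≡q   = clash-satisfied (clashᵇ-sound clash-u)
    in flip-keeps u≢w uq∈D cu≡q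
    where
    p≢b : p ≢ b
    p≢b p≡b = falsified wb∈C (trans (to (evalLit≡true⇔ c) vp-true) p≡b)

  flip-satisfies-nonResolvents : ∀ F → Satisfies c (removeClause F C) → Satisfies c′ (nonResolvents F C w)
  flip-satisfies-nonResolvents F sat-F∖C = All.tabulate λ {D} D∈NR →
    let D∈F , nonResolvable = ∈-filter⁻ (T? ∘ λ D → not (resolvableOnᵇ C D w)) {xs = F} D∈NR
    in [ (λ { refl → flip-satisfies-clause })
       , (λ D∈F∖C → flip-satisfies-nonResolvent (T-not⇒¬T nonResolvable)
                                                 (All.lookup sat-F∖C D∈F∖C)) ]
       (∈-removeClause⊎ D∈F)

blocked-model-repair :
  ∀ isX {F C w b} → isX w ≡ true → (w , b) ∈ C →
  EsImplies isX (restrict (assign1 w b) (nonResolvents F C w))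
                (restrict (assign1 w b) (resolvents F C w)) →
  ∀ y → ModelExtending (assignY isX y) (removeClause F C) → ModelExtending (assignY isX y) F
blocked-model-repair isX {F} {C} {w} {b} isXw wb∈C blocked y (c , c⊒y , sat-F∖C)
  with any? (λ l → evalLit c l ≟ true) C
... | yes sat-C = c , c⊒y , satisfies-restoreClause {c} F C sat-F∖C sat-C
... | no ¬sat-C =
  let d , d⊒y , sat-NR++RS = model-of-restrict (NR ++ RS) disjoint model-NR++RS|w
  in d , d⊒y , All-filterᵇ⁻ (λ D → resolvableOnᵇ C D w) (++⁻ʳ NR sat-NR++RS) (++⁻ˡ NR sat-NR++RS)
  where
  NR = nonResolvents F C w
  RS = resolvents F C w
  disjoint = assignY-assign1-disjoint y b isXw

  model-NR|w : ModelExtending (assignY isX y) (restrict (assign1 w b) NR)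
  model-NR|w = override (assign1 w b) c
             , override-extends-disjoint {q = assign1 w b} {c} disjoint c⊒y
             , satisfies-restrict NR (override-extends (assign1 w b) c)
                                     (flip-satisfies-nonResolvents {c} ¬sat-C wb∈C F sat-F∖C)

  model-NR++RS|w : ModelExtending (assignY isX y) (restrict (assign1 w b) (NR ++ RS))
  model-NR++RS|w =
    subst (ModelExtending (assignY isX y)) (sym (restrict-++ (assign1 w b) NR RS))
          (to (satisfiable-restrict⇔ _) (from (blocked y) (from (satisfiable-restrict⇔ _) model-NR|w)))

proposition1 : (isX : Var → Bool) (F : CNF) (C : Clause) (w : Var) →
    C ∈ F → isX w ≡ true → Blocked isX F C w →
    EsImplies isX (removeClause F C) (C ∷ []) × ExEquiv isX F (removeClause F C)
proposition1 isX F C w C∈F isXw (b , wb∈C , blocked) = esImplies , exEquiv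
  where
  models : ∀ y → ModelExtending (assignY isX y) F ⇔ ModelExtending (assignY isX y) (removeClause F C)
  models y = mk⇔ (λ (c , model) → c , Product.map₂ (satisfies-removeClause {c} C) model)
                 (blocked-model-repair isX isXw wb∈C blocked y)

  exEquiv : ExEquiv isX F (removeClause F C)
  exEquiv y = ⇔.trans (satisfiable-restrict⇔ F)
                      (⇔.trans (models y) (⇔.sym (satisfiable-restrict⇔ _)))

  esImplies : EsImplies isX (removeClause F C) (C ∷ [])
  esImplies y = ⇔.trans (satisfiable-restrict-cong (satisfies-removeClause-++ C∈F)) (exEquiv y)
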